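{- Let $S$ be a sequence over $\{x_1,\dots,x_n\}$ in which each element occurs exactly $k$ times, which is per-read-monotone and $k$-regularly-interleaving, and suppose that for every $i\in[k]$, $S^{(i)}$ is monotonically increasing with respect to $x_1<\dots<x_n$. Let $\ell$ be an index such that the $\ell$-th element of $S$ is $x_i$ (being its $c$-th occurrence) and the $(\ell+1)$-th element of $S$ is $x_j$ (being its $d$-th occurrence), with $j>i$. Then $j=i+1$.
   Context: For such a sequence $S$: $S^{(i)}$ is the subsequence of $i$-th occurrences, and for $i\neq j$, $S^{(i,j)}$ is the subsequence consisting of $i$-th and $j$-th occurrences (each element occurring twice in it). $S$ is per-read-monotone if every $S^{(i)}$ is increasing or decreasing in the order $x_1<\dots<x_n$. A sequence in which each element occurs exactly twice is $2$-regularly-interleaving if there is a partition of the elements into blocks $X_1,\dots,X_t$ such that for each block: for each $c\in\{1,2\}$ the $c$-th occurrences of its elements form a contiguous interval, and the interval of second occurrences immediately follows the interval of first occurrences. $S$ is $k$-regularly-interleaving if all $S^{(i,j)}$, $i\neq j$, are $2$-regularly-interleaving. -}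

module Defs where

open import Data.Nat using (ℕ; zero; suc; _≤_; _<_)
import Data.Nat as ℕ
open import Data.Fin using (Fin; toℕ)
import Data.Fin as F
import Data.Fin.Properties as FP
open import Data.List using (List; length; lookup; take; map; filter; allFin)
open import Data.List.Relation.Unary.Linked using (Linked)
open import Data.Product using (Σ; ∃; _×_; _,_; proj₁; proj₂)
open import Data.Sum using (_⊎_)
open import Function.Bundles using (_⇔_)
open import Relation.Binary.PropositionalEquality using (_≡_; _≢_)
open import Relation.Nullary using (¬_)

-- Sequences over {x_1,...,x_n} are lists of Fin n; x_{i+1} is represented by
-- the Fin n element with toℕ = i; the order x_1 < ... < x_n is Fin's order.
-- Positions are 0-based (Fin (length S)); occurrence numbers are 1-based.

countOf : ∀ {n} → Fin n → List (Fin n) → ℕ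
countOf x S = length (filter (FP._≟ x) S)

occ : ∀ {n} (S : List (Fin n)) → Fin (length S) → ℕ
occ S p = suc (countOf (lookup S p) (take (toℕ p) S))

annot : ∀ {n} → List (Fin n) → List (Fin n × ℕ)
annot S = map (λ p → lookup S p , occ S p) (allFin (length S))

sub1 : ∀ {n} → List (Fin n) → ℕ → List (Fin n)
sub1 S i = map proj₁ (filter (λ e → proj₂ e ℕ.≟ i) (annot S))

sub2 : ∀ {n} → List (Fin n) → ℕ → ℕ → List (Fin n)
sub2 S i j =
  map proj₁ (filter (λ e → (proj₂ e ℕ.≟ i) Relation.Nullary.⊎-dec (proj₂ e ℕ.≟ j)) (annot S))
  where import Relation.Nullary

EachOccurs : ∀ {n} → ℕ → List (Fin n) → Set
EachOccurs k S = ∀ x → countOf x S ≡ k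

Increasing Decreasing : ∀ {n} → List (Fin n) → Set
Increasing T = Linked F._<_ T
Decreasing T = Linked F._>_ T

PerReadMonotone : ∀ {n} → ℕ → List (Fin n) → Set
PerReadMonotone k S = ∀ i → 1 ≤ i → i ≤ k → Increasing (sub1 S i) ⊎ Decreasing (sub1 S i)

-- 2-regularly-interleaving: each element occurs exactly twice, and there is a
-- partition of the elements into blocks (blk : Fin n → Fin t) such that for each
-- block β the first occurrences of its elements occupy exactly the positions
-- [a,b) and the second occurrences exactly the positions [b,c) (immediately after).
TwoRegInterleaving : ∀ {n} → List (Fin n) → Set
TwoRegInterleaving {n} T =
  EachOccurs 2 T ×
  Σ ℕ λ t → Σ (Fin n → Fin t) λ blk → ∀ (β : Fin t) →
    Σ ℕ λ a → Σ ℕ λ b → Σ ℕ λ c → a ≤ b × b ≤ c ×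
      (∀ (p : Fin (length T)) →
        ((occ T p ≡ 1 × blk (lookup T p) ≡ β) ⇔ (a ≤ toℕ p × toℕ p < b)) ×
        ((occ T p ≡ 2 × blk (lookup T p) ≡ β) ⇔ (b ≤ toℕ p × toℕ p < c)))

KRegInterleaving : ∀ {n} → ℕ → List (Fin n) → Set
KRegInterleaving k S = ∀ i j → 1 ≤ i → i ≤ k → 1 ≤ j → j ≤ k → i ≢ j →
  TwoRegInterleaving (sub2 S i j)

module Submission where

-- Write p, p+1 for the adjacent positions holding x_i
-- (its c-th occurrence) and x_j (its d-th occurrence), and suppose some x_m
-- lies strictly between x_i and x_j.  Within one read all positions are
-- ordered like the elements, since every S^(r) is increasing.
--   * c < d is impossible outright: the d-th occurrence of x_i lies after p
--     but, being smaller than x_j in read d, before p+1.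
--   * c = d: the c-th occurrence of x_m would lie strictly between p and p+1.
--   * d < c: in T = S^(d,c) position p carries a second occurrence, p+1 a
--     first occurrence, while x_m has its first occurrence before p and its
--     second after p+1.  A 2-regularly-interleaving sequence admits no such
--     configuration: the block of x_m would have to contain p or p+1 in the
--     wrong half.

open import Defs
open import Data.Nat using (ℕ; zero; suc; _≤_; _<_; z≤n; s≤s)
import Data.Nat as ℕ
open import Data.Nat.Properties
open import Data.Fin using (Fin; toℕ)
import Data.Fin as F
import Data.Fin.Properties as FP
open import Data.List using (List; []; _∷_; length; lookup; take; map; filter; tabulate)
open import Data.List.Relation.Unary.Linked using ([-]; _∷_)
open import Data.Product using (Σ; _×_; _,_; proj₁; proj₂)
open import Data.Sum using (inj₁; inj₂)
open import Data.Empty using (⊥; ⊥-elim)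
open import Function using (_∘_)
open import Function.Bundles using (Equivalence)
open import Level using (0ℓ)
open import Relation.Binary.PropositionalEquality
open import Relation.Binary.Definitions using (tri<; tri≈; tri>)
open import Relation.Nullary using (yes; no)
open import Relation.Nullary.Decidable.Core using (_⊎-dec_)
open import Relation.Unary using (Pred; Decidable)

private variable
  A B : Set

data At {A : Set} : List A → ℕ → A → Set where
  here  : ∀ {x xs} → At (x ∷ xs) 0 x
  there : ∀ {y xs p x} → At xs p x → At (y ∷ xs) (suc p) x

lookup→At : (L : List A) (q : Fin (length L)) → At L (toℕ q) (lookup L q)
lookup→At (x ∷ L) F.zero    = here
lookup→At (x ∷ L) (F.suc q) = there (lookup→At L q)

At→lookup : ∀ {L : List A} {p x} → At L p x →
            Σ (Fin (length L)) λ q → toℕ q ≡ p × lookup L q ≡ x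
At→lookup here = F.zero , refl , refl
At→lookup (there h) with At→lookup h
... | q , refl , refl = F.suc q , refl , refl

At-functional : ∀ {L : List A} {p x y} → At L p x → At L p y → x ≡ y
At-functional here      here       = refl
At-functional (there h) (there h′) = At-functional h h′

At-map : ∀ {L : List A} {p x} (f : A → B) → At L p x → At (map f L) p (f x)
At-map f here      = here
At-map f (there h) = there (At-map f h)

At-tabulate : ∀ {m} (f : Fin m → A) (q : Fin m) → At (tabulate f) (toℕ q) (f q)
At-tabulate f F.zero    = here
At-tabulate f (F.suc q) = there (At-tabulate (f ∘ F.suc) q)

module FilterCount {P : Pred A 0ℓ} (P? : Decidable P) where

  -- before L p : number of entries before position p satisfying P; it is
  -- the position that an entry at p takes in  filter P? L.
  before : List A → ℕ → ℕ
  before L p = length (filter P? (take p L))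

  At-filter : ∀ {L p x} → At L p x → P x → At (filter P? L) (before L p) x
  At-filter {x = x} here Px with P? x
  ... | yes _  = here
  ... | no ¬Px = ⊥-elim (¬Px Px)
  At-filter {y ∷ L} (there h) Px with P? y
  ... | yes _ = there (At-filter h Px)
  ... | no _  = At-filter h Px

  before-suc : ∀ {L p x} → At L p x → P x → before L (suc p) ≡ suc (before L p)
  before-suc {x = x} here Px with P? x
  ... | yes _  = refl
  ... | no ¬Px = ⊥-elim (¬Px Px)
  before-suc {y ∷ L} (there h) Px with P? y
  ... | yes _ = cong suc (before-suc h Px)
  ... | no _  = before-suc h Px

  before-mono : ∀ L {p q} → p ≤ q → before L p ≤ before L q
  before-mono []      {zero}          _         = z≤n
  before-mono []      {suc p} {suc q} _         = ≤-refl
  before-mono (y ∷ L) {zero}          _         = z≤n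
  before-mono (y ∷ L) {suc p} {suc q} (s≤s p≤q) with P? y
  ... | yes _ = s≤s (before-mono L p≤q)
  ... | no _  = before-mono L p≤q

  before-≤-total : ∀ L p → before L p ≤ length (filter P? L)
  before-≤-total []      zero    = ≤-refl
  before-≤-total []      (suc p) = ≤-refl
  before-≤-total (y ∷ L) zero    = z≤n
  before-≤-total (y ∷ L) (suc p) with P? y
  ... | yes _ = s≤s (before-≤-total L p)
  ... | no _  = before-≤-total L p

  before-strict : ∀ {L p x q} → At L p x → P x → p < q → before L p < before L q
  before-strict {L} h Px p<q =
    ≤-trans (≤-reflexive (sym (before-suc h Px))) (before-mono L p<q)

  before-<-total : ∀ {L p x} → At L p x → P x → before L p < length (filter P? L)
  before-<-total {L} {p} h Px =
    ≤-trans (≤-reflexive (sym (before-suc h Px))) (before-≤-total L (suc p))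

module _ {n : ℕ} where

  -- occN S p x : the occurrence number of x at position p, written so
  -- that  occ S q ≡ occN S (toℕ q) (lookup S q)  holds definitionally.
  occN : List (Fin n) → ℕ → Fin n → ℕ
  occN S p x = suc (countOf x (take p S))

  atPosition : ∀ {L : List (Fin n)} {p x} (Q : ℕ → Fin n → ℕ → Set) →
               (∀ q → Q (toℕ q) (lookup L q) (occ L q)) →
               At L p x → Q p x (occN L p x)
  atPosition Q holds h with At→lookup h
  ... | q , refl , refl = holds q

  occN-strict : ∀ {S p q x} → At S p x → p < q → occN S p x < occN S q x
  occN-strict {x = x} h p<q = s≤s (FilterCount.before-strict (FP._≟ x) h refl p<q)

  occN-order : ∀ {S p q x} → At S p x → At S q x → occN S p x < occN S q x → p < q
  occN-order {p = p} {q} hp hq o<o with <-cmp p q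
  ... | tri< p<q _ _ = p<q
  ... | tri≈ _ refl _ = ⊥-elim (<-irrefl refl o<o)
  ... | tri> _ _ q<p = ⊥-elim (<-asym o<o (occN-strict hq q<p))

  occN-≤-count : ∀ {S p x} → At S p x → occN S p x ≤ countOf x S
  occN-≤-count {x = x} h = FilterCount.before-<-total (FP._≟ x) h refl

  occN-exists : ∀ (S : List (Fin n)) x i → 1 ≤ i → i ≤ countOf x S →
                Σ ℕ λ p → At S p x × occN S p x ≡ i
  occN-exists []      x i 1≤i i≤0 = ⊥-elim (<⇒≱ 1≤i i≤0)
  occN-exists (y ∷ S) x i 1≤i i≤count with y FP.≟ x
  occN-exists (y ∷ S) x (suc zero) _ _ | yes refl = 0 , here , refl
  occN-exists (y ∷ S) x (suc (suc i)) _ (s≤s i<count) | yes refl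
    with occN-exists S x (suc i) (s≤s z≤n) i<count
  ... | p , h , o = suc p , there h , occ-shift
    where
    occ-shift : occN (y ∷ S) (suc p) y ≡ suc (suc i)
    occ-shift with y FP.≟ y
    ... | yes _  = cong suc o
    ... | no y≢y = ⊥-elim (y≢y refl)
  occN-exists (y ∷ S) x i 1≤i i≤count | no y≢x with occN-exists S x i 1≤i i≤count
  ... | p , h , o = suc p , there h , occ-shift
    where
    occ-shift : occN (y ∷ S) (suc p) x ≡ i
    occ-shift with y FP.≟ x
    ... | yes y≡x = ⊥-elim (y≢x y≡x)
    ... | no _    = o

  twoOccurrences : ∀ {T p q x} → EachOccurs 2 T → At T p x → At T q x → p < q →
                   occN T p x ≡ 1 × occN T q x ≡ 2
  twoOccurrences {T} {p} {q} {x} each hp hq p<q =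
    firstAndSecond (occN-strict hp p<q) (subst (occN T q x ≤_) (each x) (occN-≤-count hq))
    where
    firstAndSecond : ∀ {m o} → suc m < o → o ≤ 2 → suc m ≡ 1 × o ≡ 2
    firstAndSecond {zero}  (s≤s (s≤s z≤n)) (s≤s (s≤s z≤n)) = refl , refl
    firstAndSecond {suc m} (s≤s (s≤s (s≤s _))) (s≤s (s≤s ()))

  apart : ∀ {L : List (Fin n)} {p q x y} → At L p x → At L q y → x F.< y → p ≢ q
  apart hp hq x<y refl = FP.<-irrefl (At-functional hp hq) x<y

increasing-At : ∀ {n} {T : List (Fin n)} {p q x y} → Increasing T →
                At T p x → At T q y → p < q → x F.< y
increasing-At inc here (there hq) _ = head< inc hq
  where
  head< : ∀ {n} {x : Fin n} {T q y} → Increasing (x ∷ T) → At T q y → x F.< y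
  head< (x<z ∷ _)   here       = x<z
  head< (x<z ∷ inc) (there hq) = FP.<-trans x<z (head< inc hq)
increasing-At [-]         (there ())  _           _
increasing-At (_ ∷ inc)   (there hp)  (there hq)  (s≤s p<q) = increasing-At inc hp hq p<q

module Selected {n} (S : List (Fin n)) {P : Pred (Fin n × ℕ) 0ℓ} (P? : Decidable P) where

  open FilterCount P? using (before; At-filter; before-strict; before-suc)

  sel : List (Fin n)
  sel = map proj₁ (filter P? (annot S))

  index : ℕ → ℕ
  index = before (annot S)

  At-annot : ∀ {p x} → At S p x → At (annot S) p (x , occN S p x)
  At-annot h with At→lookup h
  ... | q , refl , refl = At-map (λ r → lookup S r , occ S r) (At-tabulate (λ r → r) q)

  At-sel : ∀ {p x} → At S p x → P (x , occN S p x) → At sel (index p) x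
  At-sel h Px = At-map proj₁ (At-filter (At-annot h) Px)

  index-strict : ∀ {p q x} → At S p x → P (x , occN S p x) → p < q → index p < index q
  index-strict h Px = before-strict (At-annot h) Px

  index-suc : ∀ {p x} → At S p x → P (x , occN S p x) → index (suc p) ≡ suc (index p)
  index-suc h Px = before-suc (At-annot h) Px

readOrder : ∀ {n} {S : List (Fin n)} {p q x y} → Increasing (sub1 S (occN S p x)) →
            At S p x → At S q y → occN S q y ≡ occN S p x → x F.< y → p < q
readOrder {S = S} {p} {q} {x} inc hp hq same x<y with <-cmp p q
... | tri< p<q _ _  = p<q
... | tri≈ _ p≡q _  = ⊥-elim (apart hp hq x<y p≡q)
... | tri> _ _ q<p  = ⊥-elim (FP.<-asym x<y
       (increasing-At inc (At-sel hq same) (At-sel hp refl) (index-strict hq same q<p)))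
  where open Selected S (λ e → proj₂ e ℕ.≟ occN S p x)

blockBoundary : ∀ {n} {T : List (Fin n)} {u v q r x y z} → TwoRegInterleaving T →
                At T u x → occN T u x ≡ 2 → At T v y → occN T v y ≡ 1 → v ≡ suc u →
                At T q z → occN T q z ≡ 1 → At T r z → occN T r z ≡ 2 →
                q ≤ u → u < r → ⊥
blockBoundary {T = T} {u = u} {z = z} (_ , _ , blk , blocks) hu ou hv ov refl hq oq hr or q≤u u<r
  with blocks (blk z)
... | a , b , c , _ , _ , H with b ℕ.≤? suc u
...   | yes b≤v = 1+n≢n (trans (sym (second hv b≤v (≤-<-trans u<r (proj₂ (inSecond hr or refl))))) ov)
  where
  inSecond : ∀ {p w} → At T p w → occN T p w ≡ 2 → blk w ≡ blk z → b ≤ p × p < c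
  inSecond = atPosition (λ p w o → o ≡ 2 → blk w ≡ blk z → b ≤ p × p < c)
               (λ p o e → Equivalence.to (proj₂ (H p)) (o , e))
  second : ∀ {p w} → At T p w → b ≤ p → p < c → occN T p w ≡ 2
  second = atPosition (λ p w o → b ≤ p → p < c → o ≡ 2)
             (λ p b≤p p<c → proj₁ (Equivalence.from (proj₂ (H p)) (b≤p , p<c)))
...   | no b≰v = 1+n≢n (trans (sym ou) (first hu (≤-trans (proj₁ (inFirst hq oq refl)) q≤u) u<b))
  where
  u<b : u < b
  u<b = <-trans (n<1+n u) (≰⇒> b≰v)
  inFirst : ∀ {p w} → At T p w → occN T p w ≡ 1 → blk w ≡ blk z → a ≤ p × p < b
  inFirst = atPosition (λ p w o → o ≡ 1 → blk w ≡ blk z → a ≤ p × p < b)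
              (λ p o e → Equivalence.to (proj₁ (H p)) (o , e))
  first : ∀ {p w} → At T p w → a ≤ p → p < b → occN T p w ≡ 1
  first = atPosition (λ p w o → a ≤ p → p < b → o ≡ 1)
            (λ p a≤p p<b → proj₁ (Equivalence.from (proj₁ (H p)) (a≤p , p<b)))

module AdjacentEntries {n k} (S : List (Fin n)) (each : EachOccurs k S)
  (kreg : KRegInterleaving k S) (inc : ∀ i → 1 ≤ i → i ≤ k → Increasing (sub1 S i))
  {p x y} (hx : At S p x) (hy : At S (suc p) y) (x<y : x F.< y) where

  c d : ℕ
  c = occN S p x
  d = occN S (suc p) y

  readBound : ∀ {q w} → At S q w → occN S q w ≤ k
  readBound {w = w} h = subst (_ ≤_) (each w) (occN-≤-count h)

  sameNumber : ∀ {q w} → At S q w → ∀ v → Σ ℕ λ r → At S r v × occN S r v ≡ occN S q w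
  sameNumber h v = occN-exists S v _ (s≤s z≤n) (subst (_ ≤_) (sym (each v)) (readBound h))

  sameRead : ∀ {q r v w} → At S q v → At S r w → occN S r w ≡ occN S q v → v F.< w → q < r
  sameRead hq = readOrder (inc _ (s≤s z≤n) (readBound hq)) hq

  notBetween : ∀ {q} → p < q → q < suc p → ⊥
  notBetween p<q q<p+1 = <⇒≱ p<q (≤-pred q<p+1)

  -- c < d is impossible: the d-th occurrence of x would lie strictly between p and p+1.
  noLaterRead : c < d → ⊥
  noLaterRead c<d with sameNumber hy x
  ... | s , hs , os = notBetween (occN-order hx hs (subst (c <_) (sym os) c<d))
                                 (sameRead hs hy (sym os) x<y)

  -- c = d: the c-th occurrence of a middle element would lie between p and p+1.
  noGapSameRead : c ≡ d → ∀ {m} → x F.< m → m F.< y → ⊥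
  noGapSameRead c≡d {m} x<m m<y with sameNumber hx m
  ... | q , hq , oq = notBetween (sameRead hx hq oq x<m) (sameRead hq hy (sym (trans oq c≡d)) m<y)

  -- d < c: in S^(d,c) a middle element would straddle the block boundary
  -- between p (second occurrence of x) and p+1 (first occurrence of y).
  noGapEarlierRead : d < c → ∀ {m} → x F.< m → m F.< y → ⊥
  noGapEarlierRead d<c {m} x<m m<y
    with sameNumber hy m | sameNumber hx m | sameNumber hy x | sameNumber hx y
  ... | q , hq , oq | r , hr , or | s₀ , hs₀ , os₀ | s₁ , hs₁ , os₁ =
    blockBoundary interleaving
      (secondRead hx refl) (proj₂ x-twice) (firstRead hy refl) (proj₁ y-twice)
      (index-suc hx (inj₂ refl))
      (firstRead hq oq) (proj₁ m-twice) (secondRead hr or) (proj₂ m-twice)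
      (<⇒≤ (index-strict hq (inj₁ oq) q<p)) (index-strict hx (inj₂ refl) (<-trans (n<1+n p) p+1<r))
    where
    open Selected S (λ e → (proj₂ e ℕ.≟ d) ⊎-dec (proj₂ e ℕ.≟ c))

    interleaving : TwoRegInterleaving (sub2 S d c)
    interleaving = kreg d c (s≤s z≤n) (readBound hy) (s≤s z≤n) (readBound hx) (<⇒≢ d<c)

    firstRead : ∀ {q w} → At S q w → occN S q w ≡ d → At sel (index q) w
    firstRead h o = At-sel h (inj₁ o)

    secondRead : ∀ {q w} → At S q w → occN S q w ≡ c → At sel (index q) w
    secondRead h o = At-sel h (inj₂ o)

    q<p : q < p
    q<p = ≤∧≢⇒< (≤-pred (sameRead hq hy (sym oq) m<y)) (≢-sym (apart hx hq x<m))

    p+1<r : suc p < r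
    p+1<r = ≤∧≢⇒< (sameRead hx hr or x<m) (≢-sym (apart hr hy m<y))

    m-twice : occN sel (index q) m ≡ 1 × occN sel (index r) m ≡ 2
    m-twice = twoOccurrences (proj₁ interleaving) (firstRead hq oq) (secondRead hr or)
                (index-strict hq (inj₁ oq) (<-trans q<p (<-trans (n<1+n p) p+1<r)))

    x-twice : occN sel (index s₀) x ≡ 1 × occN sel (index p) x ≡ 2
    x-twice = twoOccurrences (proj₁ interleaving) (firstRead hs₀ os₀) (secondRead hx refl)
                (index-strict hs₀ (inj₁ os₀) (occN-order hs₀ hx (subst (_< c) (sym os₀) d<c)))

    y-twice : occN sel (index (suc p)) y ≡ 1 × occN sel (index s₁) y ≡ 2
    y-twice = twoOccurrences (proj₁ interleaving) (firstRead hy refl) (secondRead hs₁ os₁)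
                (index-strict hy (inj₁ refl) (occN-order hy hs₁ (subst (d <_) (sym os₁) d<c)))

  noElementBetween : ∀ {m} → x F.< m → m F.< y → ⊥
  noElementBetween with <-cmp c d
  ... | tri< c<d _ _ = ⊥-elim (noLaterRead c<d)
  ... | tri≈ _ c≡d _ = noGapSameRead c≡d
  ... | tri> _ _ d<c = noGapEarlierRead d<c

strictlyBetween : ∀ {n} (x y : Fin n) → suc (toℕ x) < toℕ y → Σ (Fin n) λ m → x F.< m × m F.< y
strictlyBetween x y gap = F.fromℕ< bound , ≤-reflexive (sym toℕ-m) , subst (_< toℕ y) (sym toℕ-m) gap
  where
  bound = <-trans gap (FP.toℕ<n y)
  toℕ-m = FP.toℕ-fromℕ< bound

lemma5p11 : ∀ (n k : ℕ) (S : List (Fin n)) →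
    EachOccurs k S → PerReadMonotone k S → KRegInterleaving k S →
    (∀ i → 1 ≤ i → i ≤ k → Increasing (sub1 S i)) →
    ∀ (ℓ ℓ' : Fin (length S)) → toℕ ℓ' ≡ suc (toℕ ℓ) →
    ∀ (xi xj : Fin n) → lookup S ℓ ≡ xi → lookup S ℓ' ≡ xj → xi F.< xj →
    toℕ xj ≡ suc (toℕ xi)
lemma5p11 n k S each _ kreg inc ℓ ℓ' ℓ'≡ℓ+1 xi xj Sℓ≡xi Sℓ'≡xj xi<xj
  with toℕ xj ℕ.≤? suc (toℕ xi)
... | yes xj≤xi+1 = ≤-antisym xj≤xi+1 xi<xj
... | no xj≰xi+1 with strictlyBetween xi xj (≰⇒> xj≰xi+1)
...   | m , xi<m , m<xj = ⊥-elim (noElementBetween xi<m m<xj)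
  where
  open AdjacentEntries S each kreg inc
         (subst (At S (toℕ ℓ)) Sℓ≡xi (lookup→At S ℓ))
         (subst₂ (At S) ℓ'≡ℓ+1 Sℓ'≡xj (lookup→At S ℓ')) xi<xj
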